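{- Let $n\geq 2$, let $x_1<x_2<\cdots$ be the increasing enumeration of $M_{p_n}$, let $d_k=x_{k+1}-x_k$, and let $T=T_{p_n}$ be the minimal period of $(d_k)_{k\geq1}$. For a positive integer $g$ let $\mu(g)=\#\{1\leq j\leq T: d_j=g\}$ be the multiplicity of the gap $g$ in the pattern $(d_1,\dots,d_T)$. Then: (i) $\mu(2)=\mu(4)$, and this common value is odd; (ii) $T$ is even and the central gap is $d_{T/2}=4$; moreover $\mu(g)$ is even for every $g\notin\{2,4\}$.
   Context: $p_1=2<p_2=3<p_3=5<\cdots$ denotes the sequence of all primes. For $n\geq1$, $M_{p_n}$ is the set of positive integers not divisible by any of $p_1,\dots,p_n$. The pattern $\mathcal{P}_{p_n}=(d_1,\dots,d_T)$ is one minimal period of the gap sequence, starting from $x_1=1$; the central gap is the middle entry of $(d_1,\dots,d_{T-1})$. -}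

module Defs where

open import Data.Nat using (ℕ; zero; suc; _+_; _*_; _∸_; _≤_; _<_; _≟_)
open import Data.Nat.Divisibility using (_∣_)
open import Data.Nat.Primality using (Prime)
open import Data.Product using (_×_; ∃)
open import Relation.Nullary using (¬_; yes; no)
open import Relation.Binary.PropositionalEquality using (_≡_)

-- Convention: sequences are 0-indexed in Agda; the paper's a_k (k ≥ 1) is a (k ∸ 1).

StrictlyIncreasing : (ℕ → ℕ) → Set
StrictlyIncreasing f = ∀ i j → i < j → f i < f j

IsPrimeSequence : (ℕ → ℕ) → Set
IsPrimeSequence p =
  StrictlyIncreasing p × (∀ i → Prime (p i)) × (∀ q → Prime q → ∃ λ i → p i ≡ q)

InM : (ℕ → ℕ) → ℕ → ℕ → Set
InM p n m = 1 ≤ m × (∀ i → i < n → ¬ (p i ∣ m))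

IsIncreasingEnumeration : (ℕ → Set) → (ℕ → ℕ) → Set
IsIncreasingEnumeration S x =
  StrictlyIncreasing x × (∀ k → S (x k)) × (∀ m → S m → ∃ λ k → x k ≡ m)

-- gaps x k = d_{k+1} = x_{k+2} - x_{k+1}
gaps : (ℕ → ℕ) → ℕ → ℕ
gaps x k = x (suc k) ∸ x k

IsPeriod : (ℕ → ℕ) → ℕ → Set
IsPeriod d T = ∀ k → d (T + k) ≡ d k

IsMinimalPeriod : (ℕ → ℕ) → ℕ → Set
IsMinimalPeriod d T =
  1 ≤ T × IsPeriod d T × (∀ T′ → 1 ≤ T′ → T′ < T → ¬ IsPeriod d T′)

multiplicity : (ℕ → ℕ) → ℕ → ℕ → ℕ
multiplicity d zero g = 0
multiplicity d (suc T) g with d T ≟ g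
... | yes _ = suc (multiplicity d T g)
... | no _ = multiplicity d T g

Even : ℕ → Set
Even m = ∃ λ k → m ≡ 2 * k

Odd : ℕ → Set
Odd m = ∃ λ k → m ≡ suc (2 * k)

-- Write P = p_1 ⋯ p_n = 2Q.  Then M_{p_n} is the set D of numbers coprime to P, and D is periodic
-- modulo P, symmetric under m ↦ P - m and invariant under multiplication by units modulo P.
-- For the increasing enumeration x of any decidable set with the first two properties we show
-- that K = #(D ∩ [0, P)) is a period, x (K + j) = x j + P, and x (K - 1 - i) = P - x i, so that
-- the gaps d_0, …, d_{K-2} form a palindrome.  For the sieve, a Bézout argument shows that a
-- period T translates x by a multiple of P, so the minimal period is exactly T = K.  An odd T
-- would put Q in D, although 3 ∣ Q; the central pair of a period is (Q - 2, Q + 2), whence the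
-- central gap 4; the last gap is (P + 1) - (P - 1) = 2.  By palindromy every other multiplicity
-- is doubled, so μ(2) is odd and μ(g) is even for g ∉ {2, 4}.  Finally μ(2) and μ(4) count the
-- twin and cousin pairs below P, which m ↦ (Q + 2) m mod P matches bijectively.
module Submission where

open import Defs
open import Data.Bool.Base using (Bool; true; false; not; _∧_)
open import Data.Bool.Properties using (∧-identityʳ)
open import Data.Empty using (⊥-elim)
open import Data.Nat.Base
open import Data.Nat.Properties
open import Data.Nat.Divisibility
open import Data.Nat.DivMod using (_%_; _/_; m≡m%n+[m/n]*n; m%n<n)
open import Data.Nat.Primality using (Prime; prime[2]; prime?; prime⇒irreducible; prime⇒nonTrivial)
open import Data.Nat.Coprimality as Coprime
  using (Coprime; coprime?; coprime-divisor; coprime-Bézout; 1-coprimeTo)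
open import Data.Nat.GCD using (module Bézout)
open import Data.Nat.Tactic.RingSolver using (solve-∀)
open import Data.Product.Base using (_×_; _,_; proj₁; proj₂; ∃)
open import Data.Sum.Base using (_⊎_; inj₁; inj₂)
open import Function.Bundles using (mk⇔)
open import Relation.Nullary.Negation using (¬_; contradiction)
open import Relation.Nullary.Decidable
  using (Dec; does; yes; no; from-yes; dec-true; dec-false; does-⇔)
open import Relation.Binary.Definitions using (Tri; tri<; tri≈; tri>)
open import Relation.Binary.PropositionalEquality

ind : Bool → ℕ
ind true = 1
ind false = 0

count : (ℕ → Bool) → ℕ → ℕ
count B zero = 0
count B (suc N) = ind (B N) + count B N

count-ext : ∀ {A B} N → (∀ m → m < N → A m ≡ B m) → count A N ≡ count B N
count-ext zero _ = refl
count-ext (suc N) A≡B =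
  cong₂ _+_ (cong ind (A≡B N ≤-refl)) (count-ext N (λ m m<N → A≡B m (m<n⇒m<1+n m<N)))

count-none : ∀ B N → (∀ m → m < N → B m ≡ false) → count B N ≡ 0
count-none B zero _ = refl
count-none B (suc N) miss rewrite miss N ≤-refl =
  count-none B N (λ m m<N → miss m (m<n⇒m<1+n m<N))

count-split : ∀ B u v → count B (u + v) ≡ count B u + count (λ m → B (u + m)) v
count-split B u zero = trans (cong (count B) (+-identityʳ u)) (sym (+-identityʳ _))
count-split B u (suc v) = begin
  count B (u + suc v)                       ≡⟨ cong (count B) (+-suc u v) ⟩
  ind (B (u + v)) + count B (u + v)         ≡⟨ cong (ind (B (u + v)) +_) (count-split B u v) ⟩
  ind (B (u + v)) + (count B u + rest)      ≡⟨ sym (+-assoc (ind (B (u + v))) _ rest) ⟩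
  ind (B (u + v)) + count B u + rest        ≡⟨ cong (_+ rest) (+-comm (ind (B (u + v))) _) ⟩
  count B u + ind (B (u + v)) + rest        ≡⟨ +-assoc (count B u) _ rest ⟩
  count B u + (ind (B (u + v)) + rest)      ∎
  where
  open ≡-Reasoning
  rest : ℕ
  rest = count (λ m → B (u + m)) v

count-reverse : ∀ B N → count B N ≡ count (λ m → B (N ∸ suc m)) N
count-reverse B zero = refl
count-reverse B (suc N) = begin
  ind (B N) + count B N                                 ≡⟨ cong (ind (B N) +_) (count-reverse B N) ⟩
  ind (B N) + count (λ m → B (N ∸ suc m)) N             ≡⟨ cong (_+ count (λ m → B (N ∸ suc m)) N) (sym (+-identityʳ _)) ⟩
  ind (B N) + 0 + count (λ m → B (N ∸ suc m)) N         ≡⟨ sym (count-split (λ m → B (suc N ∸ suc m)) 1 N) ⟩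
  count (λ m → B (suc N ∸ suc m)) (1 + N)               ∎
  where open ≡-Reasoning

count-skip : ∀ B a b → a < b → (∀ m → a < m → m < b → B m ≡ false) →
             count B b ≡ count B (suc a)
count-skip B a (suc b) a<1+b no-hit with m≤n⇒m<n∨m≡n (≤-pred a<1+b)
... | inj₂ refl = refl
... | inj₁ a<b rewrite no-hit b a<b ≤-refl =
  count-skip B a b a<b (λ m a<m m<b → no-hit m a<m (m<n⇒m<1+n m<b))

count-mono : ∀ B {a b} → a ≤ b → count B a ≤ count B b
count-mono B {b = zero} z≤n = ≤-refl
count-mono B {a} {suc b} a≤1+b with m≤n⇒m<n∨m≡n a≤1+b
... | inj₂ refl = ≤-refl
... | inj₁ a<1+b = ≤-trans (count-mono B (≤-pred a<1+b)) (m≤n+m _ (ind (B b)))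

count-complement : ∀ B N → count B N + count (λ m → not (B m)) N ≡ N
count-complement B zero = refl
count-complement B (suc N) with B N
... | true = cong suc (count-complement B N)
... | false = trans (+-suc (count B N) _) (cong suc (count-complement B N))

count-remove : ∀ B y M → y < M → B y ≡ true →
               count B M ≡ suc (count (λ z → B z ∧ not (does (z ≟ y))) M)
count-remove B y (suc M) y<1+M By with M ≟ y
... | yes refl rewrite By | dec-true (M ≟ M) refl =
  cong suc (count-ext M (λ z z<M → sym (unchanged z z<M)))
  where
  unchanged : ∀ z → z < M → B z ∧ not (does (z ≟ M)) ≡ B z
  unchanged z z<M rewrite dec-false (z ≟ M) (<⇒≢ z<M) = ∧-identityʳ (B z)
... | no M≢y rewrite dec-false (M ≟ y) M≢y | ∧-identityʳ (B M)
                   | count-remove B y M (≤∧≢⇒< (≤-pred y<1+M) (≢-sym M≢y)) By =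
  +-suc (ind (B M)) _

Injective< : ℕ → (ℕ → ℕ) → Set
Injective< N f = ∀ {m m′} → m < N → m′ < N → f m ≡ f m′ → m ≡ m′

count-injection : ∀ N M (A B : ℕ → Bool) (f : ℕ → ℕ) →
  (∀ m → m < N → A m ≡ true → f m < M × B (f m) ≡ true) → Injective< N f →
  count A N ≤ count B M
count-injection zero M A B f _ _ = z≤n
count-injection (suc N) M A B f hits inj with A N in AN
... | false = count-injection N M A B f (λ m m<N → hits m (m<n⇒m<1+n m<N)) inj′
  where
  inj′ : Injective< N f
  inj′ m<N m′<N = inj (m<n⇒m<1+n m<N) (m<n⇒m<1+n m′<N)
... | true with hits N ≤-refl AN
... | fN<M , BfN rewrite count-remove B (f N) M fN<M BfN =
  s≤s (count-injection N M A B′ f hits′ inj′)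
  where
  B′ : ℕ → Bool
  B′ z = B z ∧ not (does (z ≟ f N))
  inj′ : Injective< N f
  inj′ m<N m′<N = inj (m<n⇒m<1+n m<N) (m<n⇒m<1+n m′<N)
  hits′ : ∀ m → m < N → A m ≡ true → f m < M × B′ (f m) ≡ true
  hits′ m m<N Am with hits m (m<n⇒m<1+n m<N) Am
  ... | fm<M , Bfm rewrite Bfm =
    fm<M , cong not (dec-false (f m ≟ f N) (λ e → <⇒≢ m<N (inj (m<n⇒m<1+n m<N) ≤-refl e)))

count-permute : ∀ N (A B : ℕ → Bool) (f : ℕ → ℕ) →
  (∀ m → m < N → f m < N) → (∀ m → m < N → B (f m) ≡ A m) → Injective< N f →
  count A N ≡ count B N
count-permute N A B f f< B∘f inj = ≤-antisym A≤B B≤A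
  where
  A≤B : count A N ≤ count B N
  A≤B = count-injection N N A B f (λ m m<N Am → f< m m<N , trans (B∘f m m<N) Am) inj
  notA≤notB : count (λ m → not (A m)) N ≤ count (λ m → not (B m)) N
  notA≤notB = count-injection N N _ _ f
    (λ m m<N nAm → f< m m<N , trans (cong not (B∘f m m<N)) nAm) inj
  B≤A : count B N ≤ count A N
  B≤A = +-cancelʳ-≤ (count (λ m → not (B m)) N) (count B N) (count A N) (begin
    count B N + count (λ m → not (B m)) N  ≡⟨ count-complement B N ⟩
    N                                       ≡⟨ sym (count-complement A N) ⟩
    count A N + count (λ m → not (A m)) N  ≤⟨ +-monoʳ-≤ (count A N) notA≤notB ⟩
    count A N + count (λ m → not (B m)) N  ∎)
    where open ≤-Reasoning

count-palindrome : ∀ B h → (∀ j → j ≤ h + h → B (h + h ∸ j) ≡ B j) →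
                   count B (suc (h + h)) ≡ count B h + count B h + ind (B h)
count-palindrome B h sym-B = begin
  count B (suc (h + h))                             ≡⟨ cong (count B) (sym (+-suc h h)) ⟩
  count B (h + suc h)                               ≡⟨ count-split B h (suc h) ⟩
  count B h + count (λ m → B (h + m)) (suc h)       ≡⟨ cong (count B h +_) upper-half ⟩
  count B h + (count B h + ind (B h))               ≡⟨ sym (+-assoc (count B h) _ _) ⟩
  count B h + count B h + ind (B h)                 ∎
  where
  open ≡-Reasoning
  mirror : ∀ m → m < h → B (h + suc m) ≡ B (h ∸ suc m)
  mirror m m<h = trans (cong B (sym (begin
      h + h ∸ (h ∸ suc m)   ≡⟨ +-∸-assoc h (m∸n≤m h (suc m)) ⟩
      h + (h ∸ (h ∸ suc m)) ≡⟨ cong (h +_) (m∸[m∸n]≡n m<h) ⟩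
      h + suc m             ∎)))
    (sym-B (h ∸ suc m) (≤-trans (m∸n≤m h (suc m)) (m≤m+n h h)))
  upper-half : count (λ m → B (h + m)) (suc h) ≡ count B h + ind (B h)
  upper-half = begin
    count (λ m → B (h + m)) (1 + h)                         ≡⟨ count-split (λ m → B (h + m)) 1 h ⟩
    ind (B (h + 0)) + 0 + count (λ m → B (h + suc m)) h     ≡⟨ cong₂ _+_ (trans (+-identityʳ _) (cong (λ z → ind (B z)) (+-identityʳ h)))
                                                                          (count-ext h mirror) ⟩
    ind (B h) + count (λ m → B (h ∸ suc m)) h               ≡⟨ cong (ind (B h) +_) (sym (count-reverse B h)) ⟩
    ind (B h) + count B h                                   ≡⟨ +-comm (ind (B h)) _ ⟩
    count B h + ind (B h)                                   ∎

∣-∸ : ∀ {d m n} → d ∣ m → d ∣ n → d ∣ m ∸ n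
∣-∸ {d} (divides q₁ refl) (divides q₂ refl) = divides (q₁ ∸ q₂) (sym (*-distribʳ-∸ d q₁ q₂))

%-≡⇒∣∸ : ∀ {P a b} .{{_ : NonZero P}} → a % P ≡ b % P → P ∣ b ∸ a
%-≡⇒∣∸ {P} {a} {b} a%P≡b%P = divides (b / P ∸ a / P) (begin
  b ∸ a                                      ≡⟨ cong₂ _∸_ (m≡m%n+[m/n]*n b P) (m≡m%n+[m/n]*n a P) ⟩
  (b % P + b / P * P) ∸ (a % P + a / P * P)  ≡⟨ cong (λ r → (b % P + b / P * P) ∸ (r + a / P * P)) a%P≡b%P ⟩
  (b % P + b / P * P) ∸ (b % P + a / P * P)  ≡⟨ [m+n]∸[m+o]≡n∸o (b % P) _ _ ⟩
  b / P * P ∸ a / P * P                      ≡⟨ sym (*-distribʳ-∸ P (b / P) (a / P)) ⟩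
  (b / P ∸ a / P) * P                        ∎)
  where open ≡-Reasoning

module Residues (P : ℕ) where

  -- D is kept opaque: it is only ever used through the four lemmas below, and unfolding it
  -- during conversion checking would needlessly evaluate gcd computations.
  opaque
    D : ℕ → Bool
    D m = does (coprime? m P)

  opaque
    unfolding D

    D-true : ∀ {m} → Coprime m P → D m ≡ true
    D-true = dec-true (coprime? _ P)

    D-false : ∀ {m} → ¬ Coprime m P → D m ≡ false
    D-false = dec-false (coprime? _ P)

    D-sound : ∀ {m} → D m ≡ true → Coprime m P
    D-sound {m} = witness (coprime? m P)
      where
      witness : ∀ {A : Set} (a? : Dec A) → does a? ≡ true → A
      witness (yes a) _ = a

    D-cong : ∀ a b → (∀ {d} → d ∣ P → d ∣ a → d ∣ b) → (∀ {d} → d ∣ P → d ∣ b → d ∣ a) →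
             D a ≡ D b
    D-cong a b a⇒b b⇒a = does-⇔ (mk⇔ (transfer b⇒a) (transfer a⇒b)) (coprime? _ P) (coprime? _ P)
      where
      transfer : ∀ {a b} → (∀ {d} → d ∣ P → d ∣ b → d ∣ a) → Coprime a P → Coprime b P
      transfer b⇒a cop (d∣b , d∣P) = cop (b⇒a d∣P d∣b , d∣P)

  D-common-factor : ∀ {d} m → d ∣ m → d ∣ P → d ≢ 1 → D m ≡ false
  D-common-factor _ d∣m d∣P d≢1 = D-false (λ cop → d≢1 (cop (d∣m , d∣P)))

  D-shift : ∀ a t → D (a + t * P) ≡ D a
  D-shift a t = D-cong (a + t * P) a (λ d∣P d∣a+tP → ∣m+n∣n⇒∣m d∣a+tP (tP d∣P))
                       (λ d∣P d∣a → ∣m∣n⇒∣m+n d∣a (tP d∣P))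
    where
    tP : ∀ {d} → d ∣ P → d ∣ t * P
    tP = ∣n⇒∣m*n t
    ∣m+n∣n⇒∣m : ∀ {d m n} → d ∣ m + n → d ∣ n → d ∣ m
    ∣m+n∣n⇒∣m {d} {m} {n} d∣m+n d∣n = ∣m+n∣m⇒∣n (subst (d ∣_) (+-comm m n) d∣m+n) d∣n

  D-reflect : ∀ a → a ≤ P → D (P ∸ a) ≡ D a
  D-reflect a a≤P = D-cong (P ∸ a) a (λ {d} d∣P d∣P∸a → ∣m+n∣m⇒∣n (subst (d ∣_) (sym (m∸n+n≡m a≤P)) d∣P) d∣P∸a)
                           (λ d∣P d∣a → ∣-∸ d∣P d∣a)

  D-unit : ∀ {u} a → Coprime u P → D (u * a) ≡ D a
  D-unit {u} a u⊥P = D-cong (u * a) a (λ d∣P d∣ua → coprime-divisor (d⊥u d∣P) d∣ua) (λ _ → ∣n⇒∣m*n u)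
    where
    d⊥u : ∀ {d} → d ∣ P → Coprime d u
    d⊥u d∣P (e∣d , e∣u) = u⊥P (e∣u , ∣-trans e∣d d∣P)

  D-mod : ∀ a b .{{_ : NonZero P}} → D (a % P + b) ≡ D (a + b)
  D-mod a b = begin
    D (a % P + b)                 ≡⟨ sym (D-shift (a % P + b) (a / P)) ⟩
    D (a % P + b + a / P * P)     ≡⟨ cong D (+-assoc (a % P) b _) ⟩
    D (a % P + (b + a / P * P))   ≡⟨ cong (λ r → D (a % P + r)) (+-comm b _) ⟩
    D (a % P + (a / P * P + b))   ≡⟨ cong D (sym (+-assoc (a % P) _ b)) ⟩
    D (a % P + a / P * P + b)     ≡⟨ cong (λ r → D (r + b)) (sym (m≡m%n+[m/n]*n a P)) ⟩
    D (a + b)                     ∎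
    where open ≡-Reasoning

∸-∸-cancel : ∀ P a b → b ≤ P → a ≤ b → (P ∸ a) ∸ (P ∸ b) ≡ b ∸ a
∸-∸-cancel P a b b≤P a≤b = begin
  (P ∸ a) ∸ (P ∸ b)              ≡⟨ cong (λ r → (r ∸ a) ∸ (P ∸ b)) (sym (m∸n+n≡m b≤P)) ⟩
  ((P ∸ b) + b ∸ a) ∸ (P ∸ b)    ≡⟨ cong (_∸ (P ∸ b)) (+-∸-assoc (P ∸ b) a≤b) ⟩
  ((P ∸ b) + (b ∸ a)) ∸ (P ∸ b)  ≡⟨ m+n∸m≡n (P ∸ b) (b ∸ a) ⟩
  b ∸ a                          ∎
  where open ≡-Reasoning

module Enumeration (D : ℕ → Bool) (x : ℕ → ℕ) (x-incr : StrictlyIncreasing x)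
                   (x-in : ∀ k → D (x k) ≡ true)
                   (x-onto : ∀ m → D m ≡ true → ∃ λ k → x k ≡ m) where

  x-mono : ∀ {i j} → i ≤ j → x i ≤ x j
  x-mono {i} {j} i≤j with m≤n⇒m<n∨m≡n i≤j
  ... | inj₁ i<j = <⇒≤ (x-incr i j i<j)
  ... | inj₂ refl = ≤-refl

  x-reflects-< : ∀ {i j} → x i < x j → i < j
  x-reflects-< xi<xj = ≰⇒> (λ j≤i → <⇒≱ xi<xj (x-mono j≤i))

  x-between : ∀ t m → x t < m → m < x (suc t) → D m ≡ false
  x-between t m xt<m m<x[1+t] with D m in Dm
  ... | false = refl
  ... | true with x-onto m Dm
  ... | k , refl = ⊥-elim (<⇒≱ (x-reflects-< xt<m) (≤-pred (x-reflects-< m<x[1+t])))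

  x-below : ∀ m → m < x 0 → D m ≡ false
  x-below m m<x0 with D m in Dm
  ... | false = refl
  ... | true with x-onto m Dm
  ... | k , refl with x-reflects-< m<x0
  ... | ()

  x-predecessor : ∀ t m → D m ≡ true → m < x (suc t) → m ≤ x t
  x-predecessor t m Dm m<x[1+t] with x-onto m Dm
  ... | k , refl = x-mono (≤-pred (x-reflects-< m<x[1+t]))

  x-step : ∀ t → x (suc t) ≡ x t + gaps x t
  x-step t = sym (m+[n∸m]≡n (<⇒≤ (x-incr t (suc t) ≤-refl)))

  rank : ∀ t → count D (x t) ≡ t
  rank zero = count-none D (x 0) x-below
  rank (suc t) rewrite count-skip D (x t) (x (suc t)) (x-incr t (suc t) ≤-refl) (x-between t)
                     | x-in t = cong suc (rank t)

  rank-unique : ∀ m t → D m ≡ true → count D m ≡ t → m ≡ x t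
  rank-unique m t Dm rank-m with x-onto m Dm
  ... | k , refl = cong x (trans (sym (rank k)) rank-m)

  x-below-bound : ∀ i N → i < count D N → x i < N
  x-below-bound i N i<cN =
    ≰⇒> (λ N≤xi → <⇒≱ i<cN (subst (count D N ≤_) (rank i) (count-mono D N≤xi)))

  count-along : ∀ (B : ℕ → Bool) t → count (λ j → B (x j)) t ≡ count (λ m → D m ∧ B m) (x t)
  count-along B zero =
    sym (count-none (λ m → D m ∧ B m) (x 0) (λ m m<x0 → cong (_∧ B m) (x-below m m<x0)))
  count-along B (suc t) = begin
    ind (B (x t)) + count (λ j → B (x j)) t
        ≡⟨ cong₂ _+_ (cong (λ b → ind (b ∧ B (x t))) (sym (x-in t))) (count-along B t) ⟩
    ind (D (x t) ∧ B (x t)) + count D∧B (x t)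
        ≡⟨ sym (count-skip D∧B (x t) (x (suc t)) (x-incr t (suc t) ≤-refl)
                  (λ m l r → cong (_∧ B m) (x-between t m l r))) ⟩
    count D∧B (x (suc t))  ∎
    where
    open ≡-Reasoning
    D∧B : ℕ → Bool
    D∧B m = D m ∧ B m

  gap-test : ∀ t g → 1 ≤ g →
             (∀ i → 1 ≤ i → i < g → D (x t + i) ≡ true → D (x t + g) ≡ false) →
             does (gaps x t ≟ g) ≡ D (x t + g)
  gap-test t g 1≤g blocked with gaps x t ≟ g
  ... | yes gap≡g = trans (dec-true (gaps x t ≟ g) gap≡g) (sym (begin
    D (x t + g)         ≡⟨ cong (λ r → D (x t + r)) (sym gap≡g) ⟩
    D (x t + gaps x t)  ≡⟨ cong D (sym (x-step t)) ⟩
    D (x (suc t))       ≡⟨ x-in (suc t) ⟩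
    true                ∎))
    where open ≡-Reasoning
  ... | no gap≢g = trans (dec-false (gaps x t ≟ g) gap≢g) (sym (no-hit (<-cmp (gaps x t) g)))
    where
    D-next : D (x t + gaps x t) ≡ true
    D-next = trans (cong D (sym (x-step t))) (x-in (suc t))
    no-hit : Tri (gaps x t < g) (gaps x t ≡ g) (g < gaps x t) → D (x t + g) ≡ false
    no-hit (tri≈ _ gap≡g _) = ⊥-elim (gap≢g gap≡g)
    no-hit (tri< gap<g _ _) =
      blocked (gaps x t) (m<n⇒0<n∸m (x-incr t (suc t) ≤-refl)) gap<g D-next
    no-hit (tri> _ _ g<gap) =
      x-between t (x t + g) (m<m+n (x t) 1≤g)
                (subst (x t + g <_) (sym (x-step t)) (+-monoʳ-< (x t) g<gap))

  x-translate : ∀ T → IsPeriod (gaps x) T → ∀ j → x (T + j) ≡ x j + (x T ∸ x 0)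
  x-translate T period zero = begin
    x (T + 0)         ≡⟨ cong x (+-identityʳ T) ⟩
    x T               ≡⟨ sym (m+[n∸m]≡n (x-mono (z≤n {T}))) ⟩
    x 0 + (x T ∸ x 0) ∎
    where open ≡-Reasoning
  x-translate T period (suc j) = begin
    x (T + suc j)               ≡⟨ cong x (+-suc T j) ⟩
    x (suc (T + j))             ≡⟨ x-step (T + j) ⟩
    x (T + j) + gaps x (T + j)  ≡⟨ cong₂ _+_ (x-translate T period j) (period j) ⟩
    x j + S + gaps x j          ≡⟨ +-assoc (x j) S _ ⟩
    x j + (S + gaps x j)        ≡⟨ cong (x j +_) (+-comm S _) ⟩
    x j + (gaps x j + S)        ≡⟨ sym (+-assoc (x j) _ S) ⟩
    x j + gaps x j + S          ≡⟨ cong (_+ S) (sym (x-step j)) ⟩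
    x (suc j) + S               ∎
    where
    open ≡-Reasoning
    S : ℕ
    S = x T ∸ x 0

  module Periodic (P : ℕ) (D-periodic : ∀ m → D (m + P) ≡ D m) where

    K : ℕ
    K = count D P

    count-periodic : ∀ a → count D (P + a) ≡ K + count D a
    count-periodic a = trans (count-split D P a)
      (cong (K +_) (count-ext a (λ m _ → trans (cong D (+-comm P m)) (D-periodic m))))

    x-period : ∀ j → x (K + j) ≡ x j + P
    x-period j = sym (rank-unique (x j + P) (K + j) (trans (D-periodic (x j)) (x-in j)) (begin
      count D (x j + P)      ≡⟨ cong (count D) (+-comm (x j) P) ⟩
      count D (P + x j)      ≡⟨ count-periodic (x j) ⟩
      K + count D (x j)      ≡⟨ cong (K +_) (rank j) ⟩
      K + j                  ∎))
      where open ≡-Reasoning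

    K-period : IsPeriod (gaps x) K
    K-period j = begin
      x (suc (K + j)) ∸ x (K + j)      ≡⟨ cong (λ i → x i ∸ x (K + j)) (sym (+-suc K j)) ⟩
      x (K + suc j) ∸ x (K + j)        ≡⟨ cong₂ _∸_ (x-period (suc j)) (x-period j) ⟩
      (x (suc j) + P) ∸ (x j + P)      ≡⟨ cong₂ _∸_ (+-comm (x (suc j)) P) (+-comm (x j) P) ⟩
      (P + x (suc j)) ∸ (P + x j)      ≡⟨ [m+n]∸[m+o]≡n∸o P (x (suc j)) (x j) ⟩
      x (suc j) ∸ x j                  ∎
      where open ≡-Reasoning

    module Symmetric (D-reflect : ∀ a → a ≤ P → D (P ∸ a) ≡ D a) (D-P : D P ≡ false) where

      -- Reflection m ↦ P - m swaps the elements of D in [0, a] and those in [P - a, P).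
      count-reflect : ∀ a → a ≤ P → count D (suc a) + count D (P ∸ a) ≡ K
      count-reflect a a≤P = sym (begin
        K                                   ≡⟨ cong (_+ K) (cong ind (sym D-P)) ⟩
        count D (suc P)                     ≡⟨ count-reverse D (suc P) ⟩
        count D′ (suc P)                    ≡⟨ cong (λ r → count D′ (suc r)) (sym (m+[n∸m]≡n a≤P)) ⟩
        count D′ (suc a + (P ∸ a))          ≡⟨ count-split D′ (suc a) (P ∸ a) ⟩
        count D′ (suc a) + count (λ m → D′ (suc a + m)) (P ∸ a)
            ≡⟨ cong₂ _+_ (count-ext (suc a) (λ m m≤a → D-reflect m (≤-trans (≤-pred m≤a) a≤P)))
                         (count-ext (P ∸ a) (λ m _ → cong D (trans (cong (P ∸_) (sym (+-suc a m))) (sym (∸-+-assoc P a (suc m)))))) ⟩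
        count D (suc a) + count (λ m → D ((P ∸ a) ∸ suc m)) (P ∸ a)
            ≡⟨ cong (count D (suc a) +_) (sym (count-reverse D (P ∸ a))) ⟩
        count D (suc a) + count D (P ∸ a)   ∎)
        where
        open ≡-Reasoning
        D′ : ℕ → Bool
        D′ m = D (P ∸ m)

      x-reflect : ∀ i → i < K → x (K ∸ suc i) ≡ P ∸ x i
      x-reflect i i<K = sym (rank-unique (P ∸ x i) (K ∸ suc i)
        (trans (D-reflect (x i) xi≤P) (x-in i)) (begin
          count D (P ∸ x i)                                  ≡⟨ sym (m+n∸m≡n (suc i) _) ⟩
          suc i + count D (P ∸ x i) ∸ suc i                  ≡⟨ cong (λ r → r + count D (P ∸ x i) ∸ suc i) (sym rank-next) ⟩
          count D (suc (x i)) + count D (P ∸ x i) ∸ suc i    ≡⟨ cong (_∸ suc i) (count-reflect (x i) xi≤P) ⟩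
          K ∸ suc i                                          ∎))
        where
        open ≡-Reasoning
        xi≤P : x i ≤ P
        xi≤P = <⇒≤ (x-below-bound i P i<K)
        rank-next : count D (suc (x i)) ≡ suc i
        rank-next = cong₂ _+_ (cong ind (x-in i)) (rank i)

      gaps-palindrome : ∀ j → suc j < K → gaps x (K ∸ suc (suc j)) ≡ gaps x j
      gaps-palindrome j 1+j<K = begin
        x (suc (K ∸ suc (suc j))) ∸ x (K ∸ suc (suc j))  ≡⟨ cong₂ _∸_ (trans (cong x successor) (x-reflect j j<K))
                                                                       (x-reflect (suc j) 1+j<K) ⟩
        (P ∸ x j) ∸ (P ∸ x (suc j))                      ≡⟨ ∸-∸-cancel P (x j) (x (suc j))
                                                              (<⇒≤ (x-below-bound (suc j) P 1+j<K)) (x-mono (n≤1+n j)) ⟩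
        x (suc j) ∸ x j                                  ∎
        where
        open ≡-Reasoning
        j<K : j < K
        j<K = <-trans (n<1+n j) 1+j<K
        successor : suc (K ∸ suc (suc j)) ≡ K ∸ suc j
        successor = sym (+-∸-assoc 1 1+j<K)

multiple-among : ∀ e m → ∃ λ i → i < suc e × suc e ∣ m + i
multiple-among e zero = 0 , s≤s z≤n , suc e ∣0
multiple-among e (suc m) with multiple-among e m
... | suc i , 1+i≤e , d∣m+1+i = i , <-trans (n<1+n i) 1+i≤e , subst (suc e ∣_) (+-suc m i) d∣m+1+i
... | zero , _ , d∣m+0 = e , ≤-refl , subst (suc e ∣_) shift (∣m∣n⇒∣m+n d∣m+0 (∣-refl {suc e}))
  where
  shift : m + 0 + suc e ≡ suc m + e
  shift = trans (cong (_+ suc e) (+-identityʳ m)) (+-suc m e)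

even-or-odd : ∀ m → (∃ λ h → m ≡ h + h) ⊎ (∃ λ h → m ≡ suc (h + h))
even-or-odd zero = inj₁ (0 , refl)
even-or-odd (suc m) with even-or-odd m
... | inj₁ (h , m≡2h) = inj₂ (h , cong suc m≡2h)
... | inj₂ (h , m≡2h+1) = inj₁ (suc h , cong suc (trans m≡2h+1 (sym (+-suc h h))))

multiplicity-count : ∀ d t g → multiplicity d t g ≡ count (λ j → does (d j ≟ g)) t
multiplicity-count d zero g = refl
multiplicity-count d (suc t) g with d t ≟ g
... | yes dt≡g = cong₂ _+_ (cong ind (sym (dec-true (d t ≟ g) dt≡g))) (multiplicity-count d t g)
... | no dt≢g = cong₂ _+_ (cong ind (sym (dec-false (d t ≟ g) dt≢g))) (multiplicity-count d t g)

regroup-doubled : ∀ a b e → a + (e + e + b) ≡ a + b + 2 * e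
regroup-doubled = solve-∀

prime-coprime : ∀ {q m} → Prime q → ¬ q ∣ m → Coprime q m
prime-coprime pq q∤m (d∣q , d∣m) with prime⇒irreducible pq d∣q
... | inj₁ d≡1 = d≡1
... | inj₂ refl = contradiction d∣m q∤m

coprime-* : ∀ {m a b} → Coprime m a → Coprime m b → Coprime m (a * b)
coprime-* {m} {a} m⊥a m⊥b (d∣m , d∣ab) = m⊥b (d∣m , coprime-divisor d⊥a d∣ab)
  where
  d⊥a : Coprime _ a
  d⊥a (e∣d , e∣a) = m⊥a (∣-trans e∣d d∣m , e∣a)

coprime-∣-* : ∀ {a b S} → Coprime a b → a ∣ S → b ∣ S → a * b ∣ S
coprime-∣-* {a} {b} a⊥b (divides q refl) b∣qa =
  subst (a * b ∣_) (*-comm a q) (*-monoʳ-∣ a (coprime-divisor (Coprime.sym a⊥b) (subst (b ∣_) (*-comm q a) b∣qa)))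

prime-hits-progression : ∀ q S → Prime q → ¬ q ∣ S → ∃ λ j → q ∣ 1 + j * S
prime-hits-progression q S pq q∤S with coprime-Bézout (prime-coprime {q} {S} pq q∤S)
... | Bézout.+- x y eq = y , divides x eq
prime-hits-progression (suc q) S pq q∤S | Bézout.-+ x y eq =
  q * y , divides (1 + q * x) (begin
    1 + q * y * S           ≡⟨ cong suc (*-assoc q y S) ⟩
    1 + q * (y * S)         ≡⟨ cong (λ r → 1 + q * r) (sym eq) ⟩
    1 + q * (1 + x * suc q) ≡⟨ factor q x ⟩
    (1 + q * x) * suc q     ∎)
  where
  open ≡-Reasoning
  factor : ∀ q x → 1 + q * (1 + x * suc q) ≡ (1 + q * x) * suc q
  factor = solve-∀

module Primes (p : ℕ → ℕ) (ps : IsPrimeSequence p) where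

  p-incr : StrictlyIncreasing p
  p-incr = proj₁ ps

  p-prime : ∀ i → Prime (p i)
  p-prime = proj₁ (proj₂ ps)

  p≥2 : ∀ i → 2 ≤ p i
  p≥2 i = nonTrivial⇒n>1 (p i) {{prime⇒nonTrivial (p-prime i)}}

  p-mono : ∀ {i j} → i ≤ j → p i ≤ p j
  p-mono {i} {j} i≤j with m≤n⇒m<n∨m≡n i≤j
  ... | inj₁ i<j = <⇒≤ (p-incr i j i<j)
  ... | inj₂ refl = ≤-refl

  p-∣-injective : ∀ {i j} → p i ∣ p j → i ≡ j
  p-∣-injective {i} {j} pi∣pj with prime⇒irreducible (p-prime j) pi∣pj
  ... | inj₁ pi≡1 = contradiction pi≡1 (>⇒≢ (p≥2 i))
  ... | inj₂ pi≡pj with <-cmp i j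
  ... | tri< i<j _ _ = contradiction pi≡pj (<⇒≢ (p-incr i j i<j))
  ... | tri≈ _ i≡j _ = i≡j
  ... | tri> _ _ j<i = contradiction (sym pi≡pj) (<⇒≢ (p-incr j i j<i))

  p0≡2 : p 0 ≡ 2
  p0≡2 with proj₂ (proj₂ ps) 2 prime[2]
  ... | i , pi≡2 = ≤-antisym (subst (p 0 ≤_) pi≡2 (p-mono z≤n)) (p≥2 0)

  p1≡3 : p 1 ≡ 3
  p1≡3 with proj₂ (proj₂ ps) 3 (from-yes (prime? 3))
  ... | zero , p0≡3 = contradiction (trans (sym p0≡2) p0≡3) (λ ())
  ... | suc i , pi≡3 = ≤-antisym (subst (p 1 ≤_) pi≡3 (p-mono (s≤s z≤n)))
                                 (subst (_< p 1) p0≡2 (p-incr 0 1 z<s))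

  oddPrimorial : ℕ → ℕ
  oddPrimorial zero = 1
  oddPrimorial (suc j) = oddPrimorial j * p (suc j)

  oddPrimorial-positive : ∀ j → 1 ≤ oddPrimorial j
  oddPrimorial-positive zero = ≤-refl
  oddPrimorial-positive (suc j) =
    *-mono-≤ (oddPrimorial-positive j) (≤-trans (s≤s z≤n) (p≥2 (suc j)))

  factor-∣ : ∀ i j → i < j → p (suc i) ∣ oddPrimorial j
  factor-∣ i (suc j) i<1+j with m≤n⇒m<n∨m≡n (≤-pred i<1+j)
  ... | inj₁ i<j = ∣m⇒∣m*n (p (suc j)) (factor-∣ i j i<j)
  ... | inj₂ refl = n∣m*n (oddPrimorial i)

  coprime-oddPrimorial : ∀ j {m} → (∀ i → i < j → ¬ p (suc i) ∣ m) → Coprime m (oddPrimorial j)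
  coprime-oddPrimorial zero _ = Coprime.sym (1-coprimeTo _)
  coprime-oddPrimorial (suc j) p∤m =
    coprime-* (coprime-oddPrimorial j (λ i i<j → p∤m i (m<n⇒m<1+n i<j)))
              (Coprime.sym (prime-coprime (p-prime (suc j)) (p∤m j ≤-refl)))

  oddPrimorial-∣ : ∀ j {S} → (∀ i → i < j → p (suc i) ∣ S) → oddPrimorial j ∣ S
  oddPrimorial-∣ zero {S} _ = 1∣ S
  oddPrimorial-∣ (suc j) p∣S =
    coprime-∣-* (Coprime.sym (coprime-oddPrimorial j (λ i i<j pi∣pj → <⇒≢ (s≤s i<j) (p-∣-injective pi∣pj))))
                (oddPrimorial-∣ j (λ i i<j → p∣S i (m<n⇒m<1+n i<j)))
                (p∣S j ≤-refl)

  2⊥oddPrimorial : ∀ j → Coprime 2 (oddPrimorial j)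
  2⊥oddPrimorial j = coprime-oddPrimorial j (λ i _ p∣2 →
    contradiction (p-∣-injective (subst (p (suc i) ∣_) (sym p0≡2) p∣2)) (λ ()))

module Sieve (p : ℕ → ℕ) (ps : IsPrimeSequence p) (k : ℕ) where

  open Primes p ps

  n : ℕ
  n = suc (suc k)

  Q : ℕ
  Q = oddPrimorial (suc k)

  P : ℕ
  P = 2 * Q

  instance
    Q-nonZero : NonZero Q
    Q-nonZero = >-nonZero (oddPrimorial-positive (suc k))

    P-nonZero : NonZero P
    P-nonZero = >-nonZero (*-mono-≤ {1} {2} (s≤s z≤n) (oddPrimorial-positive (suc k)))

  open Residues P public

  -- P is a multiple of p 0 = 2, …, p (n-1); in particular of 2 and 3 (here n ≥ 2 is used).
  P-factor : ∀ i → i < n → p i ∣ P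
  P-factor zero _ = subst (_∣ P) (sym p0≡2) (m∣m*n Q)
  P-factor (suc i) i<n = ∣n⇒∣m*n 2 (factor-∣ i (suc k) (≤-pred i<n))

  2∣P : 2 ∣ P
  2∣P = m∣m*n Q

  3∣Q : 3 ∣ Q
  3∣Q = subst (_∣ Q) p1≡3 (factor-∣ 0 (suc k) (s≤s z≤n))

  3∣P : 3 ∣ P
  3∣P = ∣n⇒∣m*n 2 3∣Q

  sieved⇒D : ∀ {m} → (∀ i → i < n → ¬ p i ∣ m) → D m ≡ true
  sieved⇒D {m} p∤m = D-true (coprime-* m⊥2 (coprime-oddPrimorial (suc k) (λ i i<1+k → p∤m (suc i) (s≤s i<1+k))))
    where
    m⊥2 : Coprime m 2
    m⊥2 = Coprime.sym (prime-coprime prime[2] (λ 2∣m → p∤m 0 z<s (subst (_∣ m) (sym p0≡2) 2∣m)))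

  D⇒sieved : ∀ {m} → D m ≡ true → ∀ i → i < n → ¬ p i ∣ m
  D⇒sieved Dm i i<n pi∣m = contradiction (D-sound Dm (pi∣m , P-factor i i<n)) (>⇒≢ (p≥2 i))

  InM⇒D : ∀ {m} → InM p n m → D m ≡ true
  InM⇒D (_ , p∤m) = sieved⇒D p∤m

  D⇒InM : ∀ {m} → D m ≡ true → InM p n m
  D⇒InM {zero} D0 = contradiction (D-sound D0 (2 ∣0 , 2∣P)) (λ ())
  D⇒InM {suc m} Dm = s≤s z≤n , D⇒sieved Dm

  P-∣ : ∀ {S} → (∀ i → i < n → p i ∣ S) → P ∣ S
  P-∣ {S} p∣S = coprime-∣-* (2⊥oddPrimorial (suc k)) (subst (_∣ S) p0≡2 (p∣S 0 z<s))
                            (oddPrimorial-∣ (suc k) (λ i i<1+k → p∣S (suc i) (s≤s i<1+k)))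

  D-odd : ∀ m → D m ≡ true → 2 ∣ m + 1
  D-odd m Dm with multiple-among 1 m
  ... | 0 , _ , 2∣m+0 = contradiction (D-sound Dm (subst (2 ∣_) (+-identityʳ m) 2∣m+0 , 2∣P)) (λ ())
  ... | 1 , _ , 2∣m+1 = 2∣m+1
  ... | suc (suc _) , s≤s (s≤s ()) , _

  -- m, m + 2, m + 4 are never all in D: one of them is a multiple of 3.
  D-three : ∀ m → D m ≡ true → D (m + 2) ≡ true → D (m + 4) ≡ false
  D-three m Dm Dm+2 with multiple-among 2 m
  ... | 0 , _ , 3∣m+0 = contradiction (D-sound Dm (subst (3 ∣_) (+-identityʳ m) 3∣m+0 , 3∣P)) (λ ())
  ... | 1 , _ , 3∣m+1 = D-common-factor (m + 4) (subst (3 ∣_) (+-assoc m 1 3) (∣m∣n⇒∣m+n 3∣m+1 (∣-refl {3}))) 3∣P (λ ())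
  ... | 2 , _ , 3∣m+2 = contradiction (D-sound Dm+2 (3∣m+2 , 3∣P)) (λ ())
  ... | suc (suc (suc _)) , s≤s (s≤s (s≤s ())) , _

  -- The odd neighbours m + 1, m + 3 of an element m of D are even, hence not in D.
  D-odd-neighbours : ∀ m → D m ≡ true → D (m + 1) ≡ false × D (m + 3) ≡ false
  D-odd-neighbours m Dm =
    D-common-factor (m + 1) (D-odd m Dm) 2∣P (λ ()) ,
    D-common-factor (m + 3) (subst (2 ∣_) (+-assoc m 1 2) (∣m∣n⇒∣m+n (D-odd m Dm) (∣-refl {2}))) 2∣P (λ ())

  -- Inside (m, m + 2) and (m, m + 4) an element of D would exclude the right end point;
  -- this is the side condition of gap-test for the gaps 2 and 4.
  blocked-2 : ∀ m → D m ≡ true → ∀ i → 1 ≤ i → i < 2 → D (m + i) ≡ true → D (m + 2) ≡ false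
  blocked-2 m Dm 1 _ _ Dm+1 = contradiction (trans (sym Dm+1) (proj₁ (D-odd-neighbours m Dm))) (λ ())
  blocked-2 m Dm (suc (suc _)) _ (s≤s (s≤s ())) _

  blocked-4 : ∀ m → D m ≡ true → ∀ i → 1 ≤ i → i < 4 → D (m + i) ≡ true → D (m + 4) ≡ false
  blocked-4 m Dm 1 _ _ Dm+1 = contradiction (trans (sym Dm+1) (proj₁ (D-odd-neighbours m Dm))) (λ ())
  blocked-4 m Dm 2 _ _ Dm+2 = D-three m Dm Dm+2
  blocked-4 m Dm 3 _ _ Dm+3 = contradiction (trans (sym Dm+3) (proj₂ (D-odd-neighbours m Dm))) (λ ())
  blocked-4 m Dm (suc (suc (suc (suc _)))) _ (s≤s (s≤s (s≤s (s≤s ())))) _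

  D-0 : D 0 ≡ false
  D-0 = D-common-factor 0 (2 ∣0) 2∣P (λ ())

  D-1 : D 1 ≡ true
  D-1 = D-true (1-coprimeTo P)

  D-P : D P ≡ false
  D-P = D-common-factor P 2∣P 2∣P (λ ())

  D-Q : D Q ≡ false
  D-Q = D-common-factor Q 3∣Q 3∣P (λ ())

  Q≥3 : 3 ≤ Q
  Q≥3 = ∣⇒≤ 3∣Q

  2∤Q : ¬ 2 ∣ Q
  2∤Q 2∣Q = contradiction (2⊥oddPrimorial (suc k) (∣-refl {2} , 2∣Q)) (λ ())

  P≡Q+Q : P ≡ Q + Q
  P≡Q+Q = cong (Q +_) (+-identityʳ Q)

  D-near-Q : ∀ m → (∀ {d} → d ∣ m → d ∣ 2 → d ∣ Q) → (∀ {d} → d ∣ m → d ∣ Q → d ∣ 2) → D m ≡ true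
  D-near-Q m to-Q to-2 = sieved⇒D p∤m
    where
    p∤m : ∀ i → i < n → ¬ p i ∣ m
    p∤m zero _ p0∣m = 2∤Q (to-Q (subst (_∣ m) p0≡2 p0∣m) (∣-refl {2}))
    p∤m (suc i) i<n pi∣m = contradiction
      (p-∣-injective (subst (p (suc i) ∣_) (sym p0≡2) (to-2 pi∣m (factor-∣ i (suc k) (≤-pred i<n)))))
      (λ ())

  D-Q+2 : D (Q + 2) ≡ true
  D-Q+2 = D-near-Q (Q + 2) (λ {d} d∣Q+2 d∣2 → ∣m+n∣m⇒∣n (subst (d ∣_) (+-comm Q 2) d∣Q+2) d∣2)
                           (λ d∣Q+2 d∣Q → ∣m+n∣m⇒∣n d∣Q+2 d∣Q)

  D-Q∸2 : D (Q ∸ 2) ≡ true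
  D-Q∸2 = D-near-Q (Q ∸ 2) (λ d∣Q∸2 d∣2 → ∣m∸n∣n⇒∣m _ 2≤Q d∣Q∸2 d∣2)
                           (λ {d} d∣Q∸2 d∣Q → subst (d ∣_) (m∸[m∸n]≡n 2≤Q) (∣-∸ d∣Q d∣Q∸2))
    where
    2≤Q : 2 ≤ Q
    2≤Q = ≤-trans (n≤1+n 2) Q≥3

  -- Multiplication by the unit c = Q + 2 maps twin pairs (m, m + 2) to cousin pairs (cm, cm + 4)
  -- modulo P, since c (m + 2) = cm + 4 + P.  It permutes [0, P), so both kinds are equinumerous.
  c : ℕ
  c = Q + 2

  c⊥P : Coprime c P
  c⊥P = D-sound D-Q+2

  scale : ℕ → ℕ
  scale m = (c * m) % P

  scale-pairs : ∀ m → D (scale m) ∧ D (scale m + 4) ≡ D m ∧ D (m + 2)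
  scale-pairs m = cong₂ _∧_ (begin
      D ((c * m) % P)        ≡⟨ cong D (sym (+-identityʳ ((c * m) % P))) ⟩
      D ((c * m) % P + 0)    ≡⟨ D-mod (c * m) 0 ⟩
      D (c * m + 0)          ≡⟨ cong D (+-identityʳ (c * m)) ⟩
      D (c * m)              ≡⟨ D-unit m c⊥P ⟩
      D m                    ∎) (begin
      D ((c * m) % P + 4)    ≡⟨ D-mod (c * m) 4 ⟩
      D (c * m + 4)          ≡⟨ sym (D-shift (c * m + 4) 1) ⟩
      D (c * m + 4 + 1 * P)  ≡⟨ cong D (sym (expand Q m)) ⟩
      D (c * (m + 2))        ≡⟨ D-unit (m + 2) c⊥P ⟩
      D (m + 2)              ∎)
    where
    open ≡-Reasoning
    expand : ∀ q m → (q + 2) * (m + 2) ≡ (q + 2) * m + 4 + 1 * (2 * q)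
    expand = solve-∀

  -- A multiple of P in [0, b - a] with b < P forces a = b; hence scale is injective on [0, P).
  scale-cancel : ∀ {a b} → a ≤ b → b < P → scale a ≡ scale b → b ≤ a
  scale-cancel {a} {b} a≤b b<P eq = m∸n≡0⇒m≤n (small-multiple (b ∸ a) P∣b∸a (≤-<-trans (m∸n≤m b a) b<P))
    where
    P∣b∸a : P ∣ b ∸ a
    P∣b∸a = coprime-divisor (Coprime.sym c⊥P) (subst (P ∣_) (sym (*-distribˡ-∸ c b a)) (%-≡⇒∣∸ eq))
    small-multiple : ∀ d → P ∣ d → d < P → d ≡ 0
    small-multiple zero _ _ = refl
    small-multiple (suc d) P∣d d<P = contradiction P∣d (>⇒∤ d<P)

  scale-injective : Injective< P scale
  scale-injective {m} {m′} m<P m′<P eq with ≤-total m m′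
  ... | inj₁ m≤m′ = ≤-antisym m≤m′ (scale-cancel m≤m′ m′<P eq)
  ... | inj₂ m′≤m = sym (≤-antisym m′≤m (scale-cancel m′≤m m<P (sym eq)))

  twins≡cousins : count (λ m → D m ∧ D (m + 2)) P ≡ count (λ m → D m ∧ D (m + 4)) P
  twins≡cousins = count-permute P _ _ scale (λ m _ → m%n<n (c * m) P) (λ m _ → scale-pairs m) scale-injective

  module Pattern (x : ℕ → ℕ) (enum : IsIncreasingEnumeration (InM p n) x)
                 (T : ℕ) (minimal : IsMinimalPeriod (gaps x) T) where

    x-in : ∀ t → D (x t) ≡ true
    x-in t = InM⇒D (proj₁ (proj₂ enum) t)

    x-onto : ∀ m → D m ≡ true → ∃ λ t → x t ≡ m
    x-onto m Dm = proj₂ (proj₂ enum) m (D⇒InM Dm)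

    D-periodic : ∀ m → D (m + P) ≡ D m
    D-periodic m = trans (cong (λ r → D (m + r)) (sym (*-identityˡ P))) (D-shift m 1)

    open Enumeration D x (proj₁ enum) x-in x-onto
    open Periodic P D-periodic
    open Symmetric D-reflect D-P

    x0≡1 : x 0 ≡ 1
    x0≡1 with x-onto 1 D-1
    ... | t , xt≡1 = ≤-antisym (subst (x 0 ≤_) xt≡1 (x-mono z≤n)) (proj₁ (proj₁ (proj₂ enum) 0))

    K-positive : 1 ≤ K
    K-positive = subst (_≤ K) count-D-2 (count-mono D {2} {P} (*-mono-≤ {2} {2} ≤-refl (oddPrimorial-positive (suc k))))
      where
      count-D-2 : count D 2 ≡ 1
      count-D-2 rewrite D-1 | D-0 = refl

    T≤K : T ≤ K
    T≤K = ≮⇒≥ (λ K<T → proj₂ (proj₂ minimal) K K-positive K<T K-period)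

    -- Conversely T translates x by S = x T - 1, so every 1 + jS lies in D; this forces P ∣ S,
    -- hence x T = 1 + S ≥ 1 + P = x K and K ≤ T.
    S : ℕ
    S = x T ∸ x 0

    progression-in-D : ∀ j → D (1 + j * S) ≡ true
    progression-in-D zero = D-1
    progression-in-D (suc j) with x-onto (1 + j * S) (progression-in-D j)
    ... | t , xt≡1+jS = begin
      D (1 + (S + j * S))     ≡⟨ cong (λ r → D (1 + r)) (+-comm S (j * S)) ⟩
      D (1 + j * S + S)       ≡⟨ cong (λ r → D (r + S)) (sym xt≡1+jS) ⟩
      D (x t + S)             ≡⟨ cong D (sym (x-translate T (proj₁ (proj₂ minimal)) t)) ⟩
      D (x (T + t))           ≡⟨ x-in (T + t) ⟩
      true                    ∎
      where open ≡-Reasoning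

    P∣S : P ∣ S
    P∣S = P-∣ p∣S
      where
      p∣S : ∀ i → i < n → p i ∣ S
      p∣S i i<n with p i ∣? S
      ... | yes pi∣S = pi∣S
      ... | no pi∤S with prime-hits-progression (p i) S (p-prime i) pi∤S
      ... | j , pi∣1+jS = contradiction pi∣1+jS (D⇒sieved (progression-in-D j) i i<n)

    K≤T : K ≤ T
    K≤T = ≮⇒≥ λ T<K → <⇒≱ (x-incr T K T<K) (begin
      x K                 ≡⟨ cong x (sym (+-identityʳ K)) ⟩
      x (K + 0)           ≡⟨ x-period 0 ⟩
      x 0 + P             ≤⟨ +-monoʳ-≤ (x 0) (∣⇒≤ {{>-nonZero S-positive}} P∣S) ⟩
      x 0 + S             ≡⟨ m+[n∸m]≡n (x-mono z≤n) ⟩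
      x T                 ∎)
      where
      open ≤-Reasoning
      x-incr = proj₁ enum
      S-positive : 0 < S
      S-positive = m<n⇒0<n∸m (x-incr 0 T (proj₁ minimal))

    T≡K : T ≡ K
    T≡K = ≤-antisym T≤K K≤T

    -- A period of odd length 2h + 1 would give x h = P - x h, i.e. x h = Q, but 3 ∣ Q.
    K-not-odd : ∀ h → K ≢ suc (h + h)
    K-not-odd h K≡2h+1 = contradiction (trans (sym (x-in h)) (trans (cong D xh≡Q) D-Q)) (λ ())
      where
      h<K : h < K
      h<K = subst (h <_) (sym K≡2h+1) (s≤s (m≤m+n h h))
      xh≡P∸xh : x h ≡ P ∸ x h
      xh≡P∸xh = trans (cong x (sym (trans (cong (_∸ suc h) K≡2h+1) (m+n∸m≡n h h)))) (x-reflect h h<K)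
      xh≡Q : x h ≡ Q
      xh≡Q = *-cancelˡ-≡ (x h) Q 2 (begin
        x h + (x h + 0)     ≡⟨ cong (x h +_) (+-identityʳ (x h)) ⟩
        x h + x h           ≡⟨ cong (_+ x h) xh≡P∸xh ⟩
        P ∸ x h + x h       ≡⟨ m∸n+n≡m (<⇒≤ (x-below-bound h P h<K)) ⟩
        P                   ∎)
        where open ≡-Reasoning

    T-shape : ∃ λ h → T ≡ suc h + suc h
    T-shape with even-or-odd K
    ... | inj₁ (suc h , K≡) = h , trans T≡K K≡
    ... | inj₁ (zero , K≡0) = contradiction (subst (1 ≤_) K≡0 K-positive) (λ ())
    ... | inj₂ (h , K≡) = contradiction K≡ (K-not-odd h)

    x-T : x T ≡ suc P
    x-T = begin
      x T          ≡⟨ cong x (trans T≡K (sym (+-identityʳ K))) ⟩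
      x (K + 0)    ≡⟨ x-period 0 ⟩
      x 0 + P      ≡⟨ cong (_+ P) x0≡1 ⟩
      suc P        ∎
      where open ≡-Reasoning

    multiplicity-pairs : ∀ g → 1 ≤ g →
      (∀ m → D m ≡ true → ∀ i → 1 ≤ i → i < g → D (m + i) ≡ true → D (m + g) ≡ false) →
      multiplicity (gaps x) T g ≡ count (λ m → D m ∧ D (m + g)) P
    multiplicity-pairs g 1≤g blocked = begin
      multiplicity (gaps x) T g                     ≡⟨ multiplicity-count (gaps x) T g ⟩
      count (λ j → does (gaps x j ≟ g)) T           ≡⟨ count-ext T (λ j _ → gap-test j g 1≤g (blocked (x j) (x-in j))) ⟩
      count (λ j → D (x j + g)) T                   ≡⟨ count-along (λ m → D (m + g)) T ⟩
      count (λ m → D m ∧ D (m + g)) (x T)           ≡⟨ cong (count (λ m → D m ∧ D (m + g))) x-T ⟩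
      ind (D P ∧ D (P + g)) + count (λ m → D m ∧ D (m + g)) P
                                                    ≡⟨ cong (λ b → ind (b ∧ D (P + g)) + count (λ m → D m ∧ D (m + g)) P) D-P ⟩
      count (λ m → D m ∧ D (m + g)) P               ∎
      where open ≡-Reasoning

    twins-cousins : multiplicity (gaps x) T 2 ≡ multiplicity (gaps x) T 4
    twins-cousins = begin
      multiplicity (gaps x) T 2                 ≡⟨ multiplicity-pairs 2 (s≤s z≤n) blocked-2 ⟩
      count (λ m → D m ∧ D (m + 2)) P           ≡⟨ twins≡cousins ⟩
      count (λ m → D m ∧ D (m + 4)) P           ≡⟨ sym (multiplicity-pairs 4 (s≤s z≤n) blocked-4) ⟩
      multiplicity (gaps x) T 4                 ∎
      where open ≡-Reasoning

    module Shape (h : ℕ) (T≡2[1+h] : T ≡ suc h + suc h) where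

      K≡2h+2 : K ≡ suc (suc (h + h))
      K≡2h+2 = trans (sym T≡K) (trans T≡2[1+h] (cong suc (+-suc h h)))

      h<K : h < K
      h<K = subst (h <_) (sym K≡2h+2) (s≤s (≤-trans (m≤m+n h h) (n≤1+n (h + h))))

      -- The last gap is x K - x (K - 1) = (1 + P) - (P - 1) = 2.
      last-gap : gaps x (suc (h + h)) ≡ 2
      last-gap = begin
        x (suc (suc (h + h))) ∸ x (suc (h + h))   ≡⟨ cong₂ _∸_ (cong x (sym K≡2h+2)) (cong x (sym K∸1)) ⟩
        x K ∸ x (K ∸ 1)                            ≡⟨ cong₂ _∸_ (trans (cong x (sym T≡K)) x-T)
                                                                (trans (x-reflect 0 (subst (0 <_) (sym K≡2h+2) z<s))
                                                                       (cong (P ∸_) x0≡1)) ⟩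
        suc P ∸ (P ∸ 1)                            ≡⟨ cong (λ r → suc r ∸ (P ∸ 1)) (sym (m+[n∸m]≡n {1} {P} (>-nonZero⁻¹ P))) ⟩
        2 + (P ∸ 1) ∸ (P ∸ 1)                      ≡⟨ m+n∸n≡m 2 (P ∸ 1) ⟩
        2                                          ∎
        where
        open ≡-Reasoning
        K∸1 : K ∸ 1 ≡ suc (h + h)
        K∸1 = cong (_∸ 1) K≡2h+2

      -- The central pair x h < x (h + 1) = P - x h is (Q - 2, Q + 2).
      x-centre : x (suc h) ≡ P ∸ x h
      x-centre = trans (cong x (sym (trans (cong (_∸ suc h) (trans (sym T≡K) T≡2[1+h])) (m+n∸m≡n (suc h) (suc h)))))
                       (x-reflect h h<K)

      -- x h + x (h + 1) = 2Q with x h < x (h + 1), so x h < Q.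
      xh<Q : x h < Q
      xh<Q = ≰⇒> λ Q≤xh → <⇒≱ sum-bound (+-mono-≤ Q≤xh Q≤xh)
        where
        sum-bound : x h + x h < Q + Q
        sum-bound = subst (x h + x h <_) P≡Q+Q
          (m≤o∸n⇒m+n≤o (suc (x h)) (<⇒≤ (x-below-bound h P h<K))
            (subst (x h <_) x-centre (proj₁ enum h (suc h) ≤-refl)))

      r : ℕ
      r = Q ∸ 2

      Q≡2+r : Q ≡ 2 + r
      Q≡2+r = sym (m+[n∸m]≡n (≤-trans (n≤1+n 2) Q≥3))

      -- Q - 2 ∈ D lies below x (h + 1) > Q, so x h ≥ Q - 2; and x h ≠ Q - 1 since x h is odd.
      xh≡r : x h ≡ r
      xh≡r with m≤n⇒m<n∨m≡n (≤-pred (subst (x h <_) Q≡2+r xh<Q))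
      ... | inj₁ xh<1+r = ≤-antisym (≤-pred xh<1+r) r≤xh
        where
        Q<x[1+h] : Q < x (suc h)
        Q<x[1+h] = subst₂ _<_ (trans (cong (_∸ Q) P≡Q+Q) (m+n∸m≡n Q Q)) (sym x-centre)
                          (∸-monoʳ-< xh<Q (m≤m+n Q (Q + 0)))
        r≤xh : r ≤ x h
        r≤xh = x-predecessor h r D-Q∸2 (<-trans (subst (r <_) (sym Q≡2+r) (m<n+m r z<s)) Q<x[1+h])
      ... | inj₂ xh≡1+r = contradiction (subst (2 ∣_) xh+1≡Q (D-odd (x h) (x-in h))) 2∤Q
        where
        xh+1≡Q : x h + 1 ≡ Q
        xh+1≡Q = trans (cong (_+ 1) xh≡1+r) (trans (cong suc (+-comm r 1)) (sym Q≡2+r))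

      central-gap : gaps x h ≡ 4
      central-gap = begin
        x (suc h) ∸ x h       ≡⟨ cong₂ _∸_ x-centre xh≡r ⟩
        (P ∸ x h) ∸ r         ≡⟨ cong (λ a → (P ∸ a) ∸ r) xh≡r ⟩
        (P ∸ r) ∸ r           ≡⟨ ∸-+-assoc P r r ⟩
        P ∸ (r + r)           ≡⟨ cong (_∸ (r + r)) P≡2r+4 ⟩
        r + r + 4 ∸ (r + r)   ≡⟨ m+n∸m≡n (r + r) 4 ⟩
        4                     ∎
        where
        open ≡-Reasoning
        regroup : ∀ r → (2 + r) + (2 + r) ≡ r + r + 4
        regroup = solve-∀
        P≡2r+4 : P ≡ r + r + 4
        P≡2r+4 = trans P≡Q+Q (trans (cong₂ _+_ Q≡2+r Q≡2+r) (regroup r))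

      hits : ℕ → ℕ → Bool
      hits g j = does (gaps x j ≟ g)

      -- One period reads d_0 … d_{2h}, a palindrome with centre d_h = 4, followed by d_{2h+1} = 2.
      multiplicity-shape : ∀ g → multiplicity (gaps x) T g ≡
                           ind (does (2 ≟ g)) + ind (does (4 ≟ g)) + 2 * count (hits g) h
      multiplicity-shape g = begin
        multiplicity (gaps x) T g                                   ≡⟨ multiplicity-count (gaps x) T g ⟩
        count (hits g) T                                            ≡⟨ cong (count (hits g)) (trans T≡K K≡2h+2) ⟩
        ind (hits g (suc (h + h))) + count (hits g) (suc (h + h))   ≡⟨ cong₂ _+_ (cong (λ d → ind (does (d ≟ g))) last-gap)
                                                                                 (count-palindrome (hits g) h palindrome) ⟩
        ind (does (2 ≟ g)) + (#g + #g + ind (hits g h))               ≡⟨ cong (λ d → ind (does (2 ≟ g)) + (#g + #g + ind (does (d ≟ g))))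
                                                                            central-gap ⟩
        ind (does (2 ≟ g)) + (#g + #g + ind (does (4 ≟ g)))           ≡⟨ regroup-doubled (ind (does (2 ≟ g))) (ind (does (4 ≟ g))) #g ⟩
        ind (does (2 ≟ g)) + ind (does (4 ≟ g)) + 2 * #g             ∎
        where
        open ≡-Reasoning
        #g : ℕ
        #g = count (hits g) h
        palindrome : ∀ j → j ≤ h + h → hits g (h + h ∸ j) ≡ hits g j
        palindrome j j≤2h = cong (λ d → does (d ≟ g))
          (subst (λ K′ → gaps x (K′ ∸ suc (suc j)) ≡ gaps x j) K≡2h+2
                 (gaps-palindrome j (subst (suc j <_) (sym K≡2h+2) (s≤s (s≤s j≤2h)))))

      odd-multiplicity-2 : Odd (multiplicity (gaps x) T 2)
      odd-multiplicity-2 = count (hits 2) h , multiplicity-shape 2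

      even-multiplicity : ∀ g → g ≢ 2 → g ≢ 4 → Even (multiplicity (gaps x) T g)
      even-multiplicity g g≢2 g≢4 = count (hits g) h , trans (multiplicity-shape g)
        (cong₂ (λ a b → ind a + ind b + 2 * count (hits g) h)
               (dec-false (2 ≟ g) (≢-sym g≢2)) (dec-false (4 ≟ g) (≢-sym g≢4)))

theorem3 : (p : ℕ → ℕ) → IsPrimeSequence p →
           (n : ℕ) → 2 ≤ n →
           (x : ℕ → ℕ) → IsIncreasingEnumeration (InM p n) x →
           (T : ℕ) → IsMinimalPeriod (gaps x) T →
           (multiplicity (gaps x) T 2 ≡ multiplicity (gaps x) T 4
             × Odd (multiplicity (gaps x) T 2))
           × (Even T
             × gaps x (⌊ T /2⌋ ∸ 1) ≡ 4
             × (∀ g → 1 ≤ g → g ≢ 2 → g ≢ 4 → Even (multiplicity (gaps x) T g)))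
theorem3 p ps (suc zero) (s≤s ()) x enum T minimal
theorem3 p ps (suc (suc k)) _ x enum T minimal =
  let open Sieve p ps k
      open Pattern x enum T minimal
      (h , T≡2[1+h]) = T-shape
      open Shape h T≡2[1+h]
      half-T : ⌊ T /2⌋ ∸ 1 ≡ h
      half-T = cong (_∸ 1) (trans (cong ⌊_/2⌋ T≡2[1+h]) (sym (n≡⌊n+n/2⌋ (suc h))))
  in (twins-cousins , odd-multiplicity-2) ,
     (suc h , trans T≡2[1+h] (cong (suc h +_) (sym (+-identityʳ (suc h))))) ,
     subst (λ i → gaps x i ≡ 4) (sym half-T) central-gap ,
     (λ g _ → even-multiplicity g)
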